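{- Let $d\geq 2$ and let $f$ be a candidate function in $\mathcal{C}_d$. Run Algorithm OCS with function $f$ on an online instance $G=(S\cup R,E)$ that is $(d,d)$-bounded, with requests indexed $1,2,\ldots,n$ in arrival order. For a server $s$ and $r\in\{0,1,\ldots,n\}$, let $l_s^r$ be the number of neighbors of $s$ among requests $1,\ldots,r$, and let $U_s^r\in\{0,1\}$ indicate that $s$ is unmatched at the end of round $r$ (after request $r$ is processed; round $0$ is before any arrival). Then for every $A\subseteq S$ and every $r$, $$\Pr\left[\textstyle\prod_{s\in A}U_s^r=1\right]\leq \frac{1}{\prod_{s\in A} f(l_s^r)}.$$
   Context: Online bipartite matching: offline servers $S$, online requests $R$ arriving one by one; on arrival the request's neighbors are revealed and the algorithm irrevocably matches it to an unmatched neighbor or leaves it unmatched. A bipartite graph is $(k,d)$-bounded if every server has degree at least $k$ and every request has degree at most $d$. Candidate functions: for an integer $d\geq 2$, $\mathcal{C}_d$ is the set of non-decreasing functions $f:\{0,1,2,\ldots\}\to\mathbb{R}$ with $f(0)=1$ such that for all integers $0\leq m\leq d-1$ and all integers $0\leq l_1\leq\cdots\leq l_m$, $$1+\frac{\sum_{i=1}^m f(l_i)}{d-m}\geq \prod_{i=1}^m\frac{f(l_i+1)}{f(l_i)}.$$ Algorithm OCS (with function $f$): when a request $r$ arrives, for each server $s$ let $l_s$ be the number of neighbors of $s$ that arrived before $r$; let $A$ be the set of currently unmatched neighbors of $r$; if $A\neq\emptyset$, match $r$ to $s\in A$ with probability $f(l_s)/\sum_{s'\in A}f(l_{s'})$.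 -}

module Defs where

open import Level using (Level; suc; _⊔_)
open import Data.Nat as ℕ using (ℕ; zero; _∸_)
import Data.Nat as N
open import Data.Bool using (Bool; true; false; if_then_else_; _∧_; not)
open import Data.List using (List; []; _∷_; _++_; [_]; length; take; foldr; map)
open import Data.Bool.ListAction using (any)
open import Data.List.Relation.Unary.Linked using (Linked)
open import Data.Fin using (Fin; _≟_)
open import Data.Fin.Base using ()
open import Data.List using (allFin)
open import Relation.Binary.PropositionalEquality using (_≡_; _≢_)
open import Relation.Nullary using (does)
open import Data.Sum using (_⊎_)
open import Data.Product using (_×_)
open import Data.List.Relation.Unary.All using (All)

-- Ordered fields (the real numbers are one).  The inverse is total, with
-- the usual axiom only for nonzero elements.

record OrderedField (c ℓ : Level) : Set (Level.suc (c ⊔ ℓ)) where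
  infixl 6 _+_
  infixl 7 _*_
  infix 4 _≤_
  field
    Carrier : Set c
    _≤_     : Carrier → Carrier → Set ℓ
    _+_ _*_ : Carrier → Carrier → Carrier
    -_ _⁻¹  : Carrier → Carrier
    0# 1#   : Carrier
    +-assoc : ∀ x y z → (x + y) + z ≡ x + (y + z)
    +-comm  : ∀ x y → x + y ≡ y + x
    +-identityˡ : ∀ x → 0# + x ≡ x
    -‿inverseˡ : ∀ x → (- x) + x ≡ 0#
    *-assoc : ∀ x y z → (x * y) * z ≡ x * (y * z)
    *-comm  : ∀ x y → x * y ≡ y * x
    *-identityˡ : ∀ x → 1# * x ≡ x
    distribˡ : ∀ x y z → x * (y + z) ≡ (x * y) + (x * z)
    ⁻¹-inverseˡ : ∀ x → x ≢ 0# → (x ⁻¹) * x ≡ 1#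
    0≢1     : 0# ≢ 1#
    ≤-refl  : ∀ x → x ≤ x
    ≤-trans : ∀ {x y z} → x ≤ y → y ≤ z → x ≤ z
    ≤-antisym : ∀ {x y} → x ≤ y → y ≤ x → x ≡ y
    ≤-total : ∀ x y → (x ≤ y) ⊎ (y ≤ x)
    +-monoˡ-≤ : ∀ {x y} z → x ≤ y → x + z ≤ y + z
    *-nonneg : ∀ {x y} → 0# ≤ x → 0# ≤ y → 0# ≤ x * y

module _ {c ℓ} (F : OrderedField c ℓ) where
  open OrderedField F

  fromℕ : ℕ → Carrier
  fromℕ zero = 0#
  fromℕ (N.suc n) = 1# + fromℕ n

  sumL : List Carrier → Carrier
  sumL = foldr _+_ 0#

  prodL : List Carrier → Carrier
  prodL = foldr _*_ 1#

  NonDecreasing : (ℕ → Carrier) → Set ℓ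
  NonDecreasing f = ∀ a b → a N.≤ b → f a ≤ f b

  CandidateIneq : ℕ → (ℕ → Carrier) → Set ℓ
  CandidateIneq d f =
    (ls : List ℕ) → length ls N.< d → Linked N._≤_ ls →
      prodL (map (λ l → f (N.suc l) * (f l ⁻¹)) ls)
        ≤ 1# + sumL (map f ls) * (fromℕ (d ∸ length ls) ⁻¹)

  Candidate : ℕ → (ℕ → Carrier) → Set (c ⊔ ℓ)
  Candidate d f = NonDecreasing f × (f 0 ≡ 1#) × CandidateIneq d f

-- Online instances: servers Fin nS; requests given as a list in arrival
-- order, each request being its neighbourhood (a subset of servers).

Request : ℕ → Set
Request nS = Fin nS → Bool

countB : ∀ {A : Set} → (A → Bool) → List A → ℕ
countB p [] = 0
countB p (x ∷ xs) = if p x then N.suc (countB p xs) else countB p xs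

nbrCount : ∀ {nS} → List (Request nS) → Fin nS → ℕ
nbrCount rs s = countB (λ q → q s) rs

reqDeg : ∀ {nS} → Request nS → ℕ
reqDeg {nS} q = countB q (allFin nS)

Bounded : ∀ {nS} → ℕ → ℕ → List (Request nS) → Set
Bounded {nS} k d rs =
  (∀ s → k N.≤ nbrCount rs s) × All (λ q → reqDeg q N.≤ d) rs

-- Algorithm OCS: exact probability computation.
-- A state is the set of matched servers.

Matched : ℕ → Set
Matched nS = Fin nS → Bool

setTrue : ∀ {nS} → Matched nS → Fin nS → Matched nS
setTrue M s t = if does (s ≟ t) then true else M t

module OCS {c ℓ} (F : OrderedField c ℓ) (f : ℕ → OrderedField.Carrier F) where
  open OrderedField F

  allUnmatched : ∀ {nS} → (Fin nS → Bool) → Matched nS → Carrier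
  allUnmatched {nS} A M =
    if any (λ s → A s ∧ M s) (allFin nS) then 0# else 1#

  -- go A past future M : probability that, starting from state M after the
  -- requests `past` have been processed, and then processing the requests
  -- `future` with OCS, all servers of A are unmatched at the end.
  go : ∀ {nS} → (Fin nS → Bool) → List (Request nS) → List (Request nS)
     → Matched nS → Carrier
  go A past [] M = allUnmatched A M
  go {nS} A past (q ∷ qs) M =
    if any avail (allFin nS)
      then sumL F (map (λ s → (w s * (W ⁻¹)) * go A (past ++ [ q ]) qs (setTrue M s))
                     (allFin nS))
      else go A (past ++ [ q ]) qs M
    where
    avail : Fin nS → Bool
    avail s = q s ∧ not (M s)
    w : Fin nS → Carrier
    w s = if avail s then f (nbrCount past s) else 0#
    W : Carrier
    W = sumL F (map w (allFin nS))

  ProbAllUnmatched : ∀ {nS} → List (Request nS) → ℕ → (Fin nS → Bool) → Carrier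
  ProbAllUnmatched rs r A = go A [] (take r rs) (λ _ → false)

  prodF : ∀ {nS} → List (Request nS) → ℕ → (Fin nS → Bool) → Carrier
  prodF {nS} rs r A =
    prodL F (map (λ s → if A s then f (nbrCount (take r rs) s) else 1#) (allFin nS))

module Submission where

-- Let Q_r(A) = ∏_{s∈A} f(l_s^r); by induction on r, Pr[A unmatched after r] · Q_r(A) ≤ 1.
-- In round r+1, let m servers of A be neighbours of the request, of total weight c = Σ f(l_s),
-- and k = d − m.  Given that A is unmatched, A survives with probability Y/(c+Y), Y being the
-- weight of the other available neighbours, and Y/(c+Y) ≤ (k² + cY)/(k+c)².  Y is a sum of
-- f(l_s)·[s unmatched] over at most k neighbours s ∉ A, so taking expectations and using the
-- hypothesis for A and for each A ∪ {s} bounds the product by k/(k+c), which is 0 when m ≥ d.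
-- Otherwise Q_{r+1}(A) ≤ (1 + c/k)·Q_r(A) is exactly the candidate inequality.

open import Defs
open import Level using (_⊔_)
open import Data.Nat as ℕ using (ℕ; zero; suc; _∸_)
import Data.Nat.Properties as ℕ
open import Data.Sum using (inj₁; inj₂)
open import Data.Product using (_×_; _,_; proj₁; proj₂)
open import Data.Empty using (⊥-elim)
open import Data.Maybe using (Maybe; just; nothing)
open import Data.Bool using (Bool; true; false; if_then_else_; _∧_; _∨_; not)
import Data.Bool.Properties as Bool
open import Data.Bool.ListAction using (any; or)
open import Data.List using (List; []; _∷_; _++_; [_]; map; allFin; length; filterᵇ; take)
import Data.List.Properties as List
open import Data.List.Relation.Unary.All as All using (All; []; _∷_)
import Data.List.Relation.Unary.All.Properties as All
open import Data.List.Reverse using (Reverse; []; _∶_∶ʳ_; reverseView)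
open import Data.List.Membership.Propositional.Properties using (∈-allFin)
open import Data.Fin using (Fin) renaming (zero to fzero; suc to fsuc)
open import Data.List.Relation.Binary.Permutation.Propositional using (_↭_; ↭⇒↭ₛ)
import Data.List.Relation.Binary.Permutation.Propositional.Properties as ↭
open import Data.List.Sort ℕ.≤-decTotalOrder using (sort; sort-↭; sort-↗)
open import Function using (_∘_)
open import Relation.Nullary using (¬_; yes; no)
open import Relation.Binary.PropositionalEquality hiding ([_])
open import Algebra.Bundles using (CommutativeRing; CommutativeSemiring)
open import Relation.Binary.Bundles using (Preorder)
import Relation.Binary.Reasoning.Preorder
import Data.List.Relation.Binary.Permutation.Setoid.Properties


countB-∷ʳ : ∀ {X : Set} (p : X → Bool) xs x →
            countB p (xs ++ [ x ]) ≡ (if p x then suc (countB p xs) else countB p xs)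
countB-∷ʳ p []       x with p x
... | true  = refl
... | false = refl
countB-∷ʳ p (y ∷ xs) x with p y | p x | countB-∷ʳ p xs x
... | true  | true  | eq = cong suc eq
... | true  | false | eq = cong suc eq
... | false | _     | eq = eq

countB-partition : ∀ {X : Set} (p r : X → Bool) xs →
                   countB p xs ≡ countB (λ x → p x ∧ not (r x)) xs ℕ.+ countB (λ x → r x ∧ p x) xs
countB-partition p r []       = refl
countB-partition p r (x ∷ xs) with p x | r x | countB-partition p r xs
... | true  | true  | eq = trans (cong suc eq) (sym (ℕ.+-suc _ _))
... | true  | false | eq = cong suc eq
... | false | true  | eq = eq
... | false | false | eq = eq

length-filterᵇ : ∀ {X : Set} (p : X → Bool) xs → length (filterᵇ p xs) ≡ countB p xs
length-filterᵇ p []       = refl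
length-filterᵇ p (x ∷ xs) with p x
... | true  = cong suc (length-filterᵇ p xs)
... | false = length-filterᵇ p xs

any≡false⇒All : ∀ {X : Set} (p : X → Bool) xs → any p xs ≡ false → All (λ x → p x ≡ false) xs
any≡false⇒All p []       _ = []
any≡false⇒All p (x ∷ xs) any≡false with p x in px≡false
... | false = px≡false ∷ any≡false⇒All p xs any≡false

∀false⇒any≡false : ∀ {X : Set} {p : X → Bool} → (∀ x → p x ≡ false) → ∀ xs → any p xs ≡ false
∀false⇒any≡false p≗false []       = refl
∀false⇒any≡false p≗false (x ∷ xs) rewrite p≗false x = ∀false⇒any≡false p≗false xs

any-allFin≡false : ∀ {n} (p : Fin n → Bool) → any p (allFin n) ≡ false → ∀ s → p s ≡ false
any-allFin≡false p any≡false s = All.lookup (any≡false⇒All p _ any≡false) (∈-allFin s)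

map-allFin-suc : ∀ {a} {X : Set a} {n} (g : Fin (suc n) → X) →
                 map g (allFin (suc n)) ≡ g fzero ∷ map (g ∘ fsuc) (allFin n)
map-allFin-suc g = cong (g fzero ∷_)
  (trans (List.map-tabulate fsuc g) (sym (List.map-tabulate (λ s → s) (g ∘ fsuc))))

any-allFin-suc : ∀ {n} (p : Fin (suc n) → Bool) →
                 any p (allFin (suc n)) ≡ p fzero ∨ any (p ∘ fsuc) (allFin n)
any-allFin-suc p = cong or (map-allFin-suc p)

any-setTrue-∧ : ∀ {n} (X Y : Fin n → Bool) s →
  any (λ t → setTrue X s t ∧ Y t) (allFin n) ≡ Y s ∨ any (λ t → X t ∧ Y t) (allFin n)
any-setTrue-∧ {suc n} X Y fzero
  rewrite any-allFin-suc (λ t → setTrue X fzero t ∧ Y t) | any-allFin-suc (λ t → X t ∧ Y t)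
  with X fzero | Y fzero
... | true  | true  = refl
... | true  | false = refl
... | false | true  = refl
... | false | false = refl
any-setTrue-∧ {suc n} X Y (fsuc s)
  rewrite any-allFin-suc (λ t → setTrue X (fsuc s) t ∧ Y t) | any-allFin-suc (λ t → X t ∧ Y t)
        | any-setTrue-∧ (X ∘ fsuc) (Y ∘ fsuc) s
  = trans (sym (Bool.∨-assoc (X fzero ∧ Y fzero) (Y (fsuc s)) _))
      (trans (cong (_∨ _) (Bool.∨-comm (X fzero ∧ Y fzero) (Y (fsuc s))))
             (Bool.∨-assoc (Y (fsuc s)) _ _))

any-∧-setTrue : ∀ {n} (X Y : Fin n → Bool) s →
  any (λ t → X t ∧ setTrue Y s t) (allFin n) ≡ X s ∨ any (λ t → X t ∧ Y t) (allFin n)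
any-∧-setTrue {n} X Y s = begin
  any (λ t → X t ∧ setTrue Y s t) (allFin n)
    ≡⟨ any-cong (λ t → Bool.∧-comm (X t) (setTrue Y s t)) ⟩
  any (λ t → setTrue Y s t ∧ X t) (allFin n)
    ≡⟨ any-setTrue-∧ Y X s ⟩
  X s ∨ any (λ t → Y t ∧ X t) (allFin n)
    ≡⟨ cong (X s ∨_) (any-cong (λ t → Bool.∧-comm (Y t) (X t))) ⟩
  X s ∨ any (λ t → X t ∧ Y t) (allFin n)
    ∎
  where
  open ≡-Reasoning
  any-cong : ∀ {p p′ : Fin n → Bool} → (∀ t → p t ≡ p′ t) → any p (allFin n) ≡ any p′ (allFin n)
  any-cong p≗p′ = cong or (List.map-cong p≗p′ (allFin n))

module OrderedFieldProperties {c ℓ} (F : OrderedField c ℓ) where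
  open OrderedField F

  +-identityʳ : ∀ x → x + 0# ≡ x
  +-identityʳ x = trans (+-comm x 0#) (+-identityˡ x)

  *-identityʳ : ∀ x → x * 1# ≡ x
  *-identityʳ x = trans (*-comm x 1#) (*-identityˡ x)

  commutativeRing : CommutativeRing c c
  commutativeRing = record { isCommutativeRing = record
    { isRing = record
      { +-isAbelianGroup = record
        { isGroup = record
          { isMonoid = record
            { isSemigroup = record
              { isMagma = record { isEquivalence = isEquivalence ; ∙-cong = cong₂ _+_ }
              ; assoc = +-assoc }
            ; identity = +-identityˡ , +-identityʳ }
          ; inverse = -‿inverseˡ , λ x → trans (+-comm x (- x)) (-‿inverseˡ x)
          ; ⁻¹-cong = cong -_ }
        ; comm = +-comm }
      ; *-cong = cong₂ _*_
      ; *-assoc = *-assoc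
      ; *-identity = *-identityˡ , *-identityʳ
      ; distrib = distribˡ , λ x y z → trans (*-comm (y + z) x)
                    (trans (distribˡ x y z) (cong₂ _+_ (*-comm x y) (*-comm x z))) }
    ; *-comm = *-comm } }

  open CommutativeRing commutativeRing public
    using (zeroˡ; zeroʳ; -‿inverseʳ; *-isCommutativeMonoid; +-isCommutativeMonoid)
  open import Algebra.Properties.Ring (CommutativeRing.ring commutativeRing) public
    using (-‿distribˡ-*; -‿involutive; [y-z]x≈yx-zx)

  private
    semiring = CommutativeSemiring.semiring (CommutativeRing.commutativeSemiring commutativeRing)
  open import Algebra.Properties.Semiring.Mult semiring using () renaming (_×_ to _×#_)

  private
    ℕ-coefficients≟ : ∀ m n → Maybe (m ×# 1# ≡ n ×# 1#)
    ℕ-coefficients≟ m n with m ℕ.≟ n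
    ... | yes refl = just refl
    ... | no _     = nothing

  open import Algebra.Solver.Ring.NaturalCoefficients
    (CommutativeRing.commutativeSemiring commutativeRing) ℕ-coefficients≟ public

  ≤-reflexive : ∀ {x y} → x ≡ y → x ≤ y
  ≤-reflexive {x} refl = ≤-refl x

  ≤-preorder : Preorder c c ℓ
  ≤-preorder = record { isPreorder = record
    { isEquivalence = isEquivalence ; reflexive = ≤-reflexive ; trans = ≤-trans } }

  module ≤-Reasoning = Relation.Binary.Reasoning.Preorder ≤-preorder

  ≤-respˡ-≡ : ∀ {x x′ y} → x ≡ x′ → x ≤ y → x′ ≤ y
  ≤-respˡ-≡ refl x≤y = x≤y

  ≤-respʳ-≡ : ∀ {x y y′} → y ≡ y′ → x ≤ y → x ≤ y′
  ≤-respʳ-≡ refl x≤y = x≤y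

  +-monoʳ-≤ : ∀ {x y} z → x ≤ y → z + x ≤ z + y
  +-monoʳ-≤ {x} {y} z x≤y = ≤-respˡ-≡ (+-comm x z) (≤-respʳ-≡ (+-comm y z) (+-monoˡ-≤ z x≤y))

  +-mono-≤ : ∀ {x y u v} → x ≤ y → u ≤ v → x + u ≤ y + v
  +-mono-≤ {y = y} {u} x≤y u≤v = ≤-trans (+-monoˡ-≤ u x≤y) (+-monoʳ-≤ y u≤v)

  +-cancelʳ-≤ : ∀ {x y} z → x + z ≤ y + z → x ≤ y
  +-cancelʳ-≤ {x} {y} z x+z≤y+z =
    ≤-respˡ-≡ (cancel x) (≤-respʳ-≡ (cancel y) (+-monoˡ-≤ (- z) x+z≤y+z))
    where
    cancel : ∀ u → (u + z) + - z ≡ u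
    cancel u = trans (+-assoc u z (- z)) (trans (cong (u +_) (-‿inverseʳ z)) (+-identityʳ u))

  x≤y⇒0≤y-x : ∀ {x y} → x ≤ y → 0# ≤ y + - x
  x≤y⇒0≤y-x {x} x≤y = ≤-respˡ-≡ (-‿inverseʳ x) (+-monoˡ-≤ (- x) x≤y)

  -x*-x≡x*x : ∀ x → - x * - x ≡ x * x
  -x*-x≡x*x x = trans (sym (-‿distribˡ-* x (- x)))
    (trans (cong -_ (trans (*-comm x (- x)) (sym (-‿distribˡ-* x x)))) (-‿involutive (x * x)))

  0≤x*x : ∀ x → 0# ≤ x * x
  0≤x*x x with ≤-total 0# x
  ... | inj₁ 0≤x = *-nonneg 0≤x 0≤x
  ... | inj₂ x≤0 = ≤-respʳ-≡ (-x*-x≡x*x x) (*-nonneg 0≤-x 0≤-x)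
    where
    0≤-x : 0# ≤ - x
    0≤-x = ≤-respʳ-≡ (+-identityˡ (- x)) (x≤y⇒0≤y-x x≤0)

  0≤1 : 0# ≤ 1#
  0≤1 = ≤-respʳ-≡ (*-identityˡ 1#) (0≤x*x 1#)

  1≰0 : ¬ (1# ≤ 0#)
  1≰0 1≤0 = 0≢1 (≤-antisym 0≤1 1≤0)

  *-monoʳ-≤ : ∀ {x y} z → 0# ≤ z → x ≤ y → x * z ≤ y * z
  *-monoʳ-≤ {x} {y} z 0≤z x≤y = +-cancelʳ-≤ (- (x * z))
    (≤-respˡ-≡ (sym (-‿inverseʳ (x * z)))
      (≤-respʳ-≡ ([y-z]x≈yx-zx z y x) (*-nonneg (x≤y⇒0≤y-x x≤y) 0≤z)))

  *-monoˡ-≤ : ∀ {x y} z → 0# ≤ z → x ≤ y → z * x ≤ z * y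
  *-monoˡ-≤ {x} {y} z 0≤z x≤y =
    ≤-respˡ-≡ (*-comm x z) (≤-respʳ-≡ (*-comm y z) (*-monoʳ-≤ z 0≤z x≤y))

  1≤x*y : ∀ {x y} → 1# ≤ x → 1# ≤ y → 1# ≤ x * y
  1≤x*y {x} {y} 1≤x 1≤y =
    ≤-trans 1≤y (≤-respˡ-≡ (*-identityˡ y) (*-monoʳ-≤ y (≤-trans 0≤1 1≤y) 1≤x))

  Positive : Carrier → Set (c ⊔ ℓ)
  Positive x = 0# ≤ x × x ≢ 0#

  1≤⇒positive : ∀ {x} → 1# ≤ x → Positive x
  1≤⇒positive 1≤x = ≤-trans 0≤1 1≤x , λ { refl → 1≰0 1≤x }

  x*x⁻¹≡1 : ∀ {x} → x ≢ 0# → x * x ⁻¹ ≡ 1#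
  x*x⁻¹≡1 {x} x≢0 = trans (*-comm x (x ⁻¹)) (⁻¹-inverseˡ x x≢0)

  0≤x⁻¹ : ∀ {x} → Positive x → 0# ≤ x ⁻¹
  0≤x⁻¹ {x} (0≤x , x≢0) with ≤-total 0# (x ⁻¹)
  ... | inj₁ 0≤x⁻¹ = 0≤x⁻¹
  ... | inj₂ x⁻¹≤0 = ⊥-elim (1≰0
    (≤-respˡ-≡ (⁻¹-inverseˡ x x≢0) (≤-respʳ-≡ (zeroˡ x) (*-monoʳ-≤ x 0≤x x⁻¹≤0))))

  positive-* : ∀ {x y} → Positive x → Positive y → Positive (x * y)
  positive-* {x} {y} (0≤x , x≢0) (0≤y , y≢0) = *-nonneg 0≤x 0≤y , λ xy≡0 → y≢0 (begin
    y                ≡⟨ sym (*-identityˡ y) ⟩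
    1# * y           ≡⟨ cong (_* y) (sym (⁻¹-inverseˡ x x≢0)) ⟩
    (x ⁻¹ * x) * y   ≡⟨ *-assoc (x ⁻¹) x y ⟩
    x ⁻¹ * (x * y)   ≡⟨ cong (x ⁻¹ *_) xy≡0 ⟩
    x ⁻¹ * 0#        ≡⟨ zeroʳ (x ⁻¹) ⟩
    0#               ∎)
    where open ≡-Reasoning

  x*y≤1⇒x≤y⁻¹ : ∀ {x y} → Positive y → x * y ≤ 1# → x ≤ y ⁻¹
  x*y≤1⇒x≤y⁻¹ {x} {y} y>0@(_ , y≢0) xy≤1 =
    ≤-respˡ-≡ x*y*y⁻¹≡x (≤-respʳ-≡ (*-identityˡ (y ⁻¹)) (*-monoʳ-≤ (y ⁻¹) (0≤x⁻¹ y>0) xy≤1))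
    where
    x*y*y⁻¹≡x : x * y * y ⁻¹ ≡ x
    x*y*y⁻¹≡x = trans (*-assoc x y (y ⁻¹)) (trans (cong (x *_) (x*x⁻¹≡1 y≢0)) (*-identityʳ x))

  cross-multiply-≤ : ∀ {u v u′ v′} → Positive v → Positive v′ →
                     u * v′ ≤ u′ * v → u * v ⁻¹ ≤ u′ * v′ ⁻¹
  cross-multiply-≤ {u} {v} {u′} {v′} v>0@(_ , v≢0) v′>0@(_ , v′≢0) uv′≤u′v =
    ≤-respˡ-≡ (cancel u v′ v v′≢0)
      (≤-respʳ-≡ (trans (cong ((u′ * v) *_) (*-comm (v ⁻¹) (v′ ⁻¹))) (cancel u′ v v′ v≢0))
        (*-monoʳ-≤ (v ⁻¹ * v′ ⁻¹) (*-nonneg (0≤x⁻¹ v>0) (0≤x⁻¹ v′>0)) uv′≤u′v))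
    where
    cancel : ∀ a b e → b ≢ 0# → (a * b) * (e ⁻¹ * b ⁻¹) ≡ a * e ⁻¹
    cancel a b e b≢0 = begin
      (a * b) * (e ⁻¹ * b ⁻¹)  ≡⟨ solve 4 (λ a b e′ b′ → (a :* b) :* (e′ :* b′) := (a :* e′) :* (b :* b′))
                                     refl a b (e ⁻¹) (b ⁻¹) ⟩
      (a * e ⁻¹) * (b * b ⁻¹)  ≡⟨ cong ((a * e ⁻¹) *_) (x*x⁻¹≡1 b≢0) ⟩
      (a * e ⁻¹) * 1#          ≡⟨ *-identityʳ _ ⟩
      a * e ⁻¹                 ∎
      where open ≡-Reasoning

  fromℕ-+ : ∀ m n → fromℕ F (m ℕ.+ n) ≡ fromℕ F m + fromℕ F n
  fromℕ-+ zero    n = sym (+-identityˡ _)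
  fromℕ-+ (suc m) n = trans (cong (1# +_) (fromℕ-+ m n)) (sym (+-assoc 1# _ _))

  0≤fromℕ : ∀ n → 0# ≤ fromℕ F n
  0≤fromℕ zero    = ≤-refl 0#
  0≤fromℕ (suc n) = ≤-respˡ-≡ (+-identityˡ 0#) (+-mono-≤ 0≤1 (0≤fromℕ n))

  fromℕ-mono-≤ : ∀ {m n} → m ℕ.≤ n → fromℕ F m ≤ fromℕ F n
  fromℕ-mono-≤ {m} m≤n with ℕ.m≤n⇒∃[o]m+o≡n m≤n
  ... | o , refl = ≤-respˡ-≡ (+-identityʳ _)
                     (≤-respʳ-≡ (sym (fromℕ-+ m o)) (+-monoʳ-≤ (fromℕ F m) (0≤fromℕ o)))

  1≤fromℕ : ∀ {n} → 1 ℕ.≤ n → 1# ≤ fromℕ F n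
  1≤fromℕ 1≤n = ≤-respˡ-≡ (+-identityʳ 1#) (fromℕ-mono-≤ 1≤n)

  2xy≤x²+y² : ∀ x y → x * y + x * y ≤ x * x + y * y
  2xy≤x²+y² x y = ≤-respˡ-≡ (+-identityˡ _)
    (≤-respʳ-≡ square-expansion (+-monoˡ-≤ (x * y + x * y) (0≤x*x (x + - y))))
    where
    open ≡-Reasoning
    square-expansion : (x + - y) * (x + - y) + (x * y + x * y) ≡ x * x + y * y
    square-expansion = begin
      (x + - y) * (x + - y) + (x * y + x * y)
        ≡⟨ solve 3 (λ x y y′ → (x :+ y′) :* (x :+ y′) :+ (x :* y :+ x :* y)
                            := (x :* x :+ y′ :* y′) :+ (x :* (y :+ y′) :+ x :* (y :+ y′)))
                   refl x y (- y) ⟩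
      (x * x + - y * - y) + (x * (y + - y) + x * (y + - y))
        ≡⟨ cong₂ (λ a b → (x * x + a) + (x * b + x * b)) (-x*-x≡x*x y) (-‿inverseʳ y) ⟩
      (x * x + y * y) + (x * 0# + x * 0#)
        ≡⟨ cong (λ a → (x * x + y * y) + (a + a)) (zeroʳ x) ⟩
      (x * x + y * y) + (0# + 0#)
        ≡⟨ trans (cong ((x * x + y * y) +_) (+-identityˡ 0#)) (+-identityʳ _) ⟩
      x * x + y * y ∎

  -- The right-hand side is the tangent line at y = k of the concave map y ↦ y / (c + y).
  y/[c+y]≤tangent : ∀ k c y → 0# ≤ c → Positive (c + y) → Positive (k + c) →
                    y * (c + y) ⁻¹ ≤ (k * k + c * y) * ((k + c) * (k + c)) ⁻¹
  y/[c+y]≤tangent k c y 0≤c c+y>0 k+c>0 =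
    cross-multiply-≤ c+y>0 (positive-* k+c>0 k+c>0) (+-cancelʳ-≤ (c * (k * k + y * y))
      (≤-respˡ-≡ expand (+-monoʳ-≤ _ (*-monoˡ-≤ c 0≤c (2xy≤x²+y² k y)))))
    where
    expand : (k * k + c * y) * (c + y) + c * (k * y + k * y)
           ≡ y * ((k + c) * (k + c)) + c * (k * k + y * y)
    expand = solve 3 (λ k c y → (k :* k :+ c :* y) :* (c :+ y) :+ c :* (k :* y :+ k :* y)
                             := y :* ((k :+ c) :* (k :+ c)) :+ c :* (k :* k :+ y :* y)) refl k c y

module BigOperators {c ℓ} (F : OrderedField c ℓ) where
  open OrderedField F
  open OrderedFieldProperties F
  private
    module ↭ₛ = Data.List.Relation.Binary.Permutation.Setoid.Properties (setoid Carrier)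

  module _ {X : Set} where

    ∑ : (X → Carrier) → List X → Carrier
    ∑ g xs = sumL F (map g xs)

    ∏ : (X → Carrier) → List X → Carrier
    ∏ g xs = prodL F (map g xs)

    ∑-cong : ∀ {g h} → (∀ x → g x ≡ h x) → ∀ xs → ∑ g xs ≡ ∑ h xs
    ∑-cong g≗h xs = cong (sumL F) (List.map-cong g≗h xs)

    ∏-cong : ∀ {g h} → (∀ x → g x ≡ h x) → ∀ xs → ∏ g xs ≡ ∏ h xs
    ∏-cong g≗h xs = cong (prodL F) (List.map-cong g≗h xs)

    ∑-+ : ∀ g h xs → ∑ (λ x → g x + h x) xs ≡ ∑ g xs + ∑ h xs
    ∑-+ g h []       = sym (+-identityˡ 0#)
    ∑-+ g h (x ∷ xs) = trans (cong (g x + h x +_) (∑-+ g h xs))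
      (solve 4 (λ a b u v → a :+ b :+ (u :+ v) := a :+ u :+ (b :+ v))
               refl (g x) (h x) (∑ g xs) (∑ h xs))

    ∑-*ˡ : ∀ a g xs → ∑ (λ x → a * g x) xs ≡ a * ∑ g xs
    ∑-*ˡ a g []       = sym (zeroʳ a)
    ∑-*ˡ a g (x ∷ xs) = trans (cong (a * g x +_) (∑-*ˡ a g xs)) (sym (distribˡ a (g x) (∑ g xs)))

    ∑-*ʳ : ∀ a g xs → ∑ (λ x → g x * a) xs ≡ ∑ g xs * a
    ∑-*ʳ a g xs = trans (∑-cong (λ x → *-comm (g x) a) xs) (trans (∑-*ˡ a g xs) (*-comm a _))

    ∑-zero : ∀ {g} → (∀ x → g x ≡ 0#) → ∀ xs → ∑ g xs ≡ 0#
    ∑-zero g≗0 []       = refl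
    ∑-zero g≗0 (x ∷ xs) = trans (cong₂ _+_ (g≗0 x) (∑-zero g≗0 xs)) (+-identityˡ 0#)

    ∑-mono-≤ : ∀ {g h} → (∀ x → g x ≤ h x) → ∀ xs → ∑ g xs ≤ ∑ h xs
    ∑-mono-≤ g≤h []       = ≤-refl 0#
    ∑-mono-≤ g≤h (x ∷ xs) = +-mono-≤ (g≤h x) (∑-mono-≤ g≤h xs)

    0≤∑ : ∀ {g} → (∀ x → 0# ≤ g x) → ∀ xs → 0# ≤ ∑ g xs
    0≤∑ 0≤g xs = ≤-respˡ-≡ (∑-zero (λ _ → refl) xs) (∑-mono-≤ 0≤g xs)

    1≤∑ : ∀ (p : X → Bool) {g} → (∀ x → 0# ≤ g x) → (∀ x → p x ≡ true → 1# ≤ g x) →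
          ∀ xs → any p xs ≡ true → 1# ≤ ∑ g xs
    1≤∑ p 0≤g 1≤g (x ∷ xs) any≡true with p x in px≡true
    ... | true  = ≤-respˡ-≡ (+-identityʳ 1#) (+-mono-≤ (1≤g x px≡true) (0≤∑ 0≤g xs))
    ... | false = ≤-respˡ-≡ (+-identityˡ 1#) (+-mono-≤ (0≤g x) (1≤∑ p 0≤g 1≤g xs any≡true))

    ∑-indicator : ∀ (p : X → Bool) xs →
                  ∑ (λ x → if p x then 1# else 0#) xs ≡ fromℕ F (countB p xs)
    ∑-indicator p []       = refl
    ∑-indicator p (x ∷ xs) with p x
    ... | true  = cong (1# +_) (∑-indicator p xs)
    ... | false = trans (+-identityˡ _) (∑-indicator p xs)

    ∏-* : ∀ g h xs → ∏ (λ x → g x * h x) xs ≡ ∏ g xs * ∏ h xs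
    ∏-* g h []       = sym (*-identityˡ 1#)
    ∏-* g h (x ∷ xs) = trans (cong (g x * h x *_) (∏-* g h xs))
      (solve 4 (λ a b u v → a :* b :* (u :* v) := a :* u :* (b :* v))
               refl (g x) (h x) (∏ g xs) (∏ h xs))

    ∏-one : ∀ xs → ∏ (λ _ → 1#) xs ≡ 1#
    ∏-one []       = refl
    ∏-one (x ∷ xs) = trans (cong (1# *_) (∏-one xs)) (*-identityˡ 1#)

    1≤∏ : ∀ {g} → (∀ x → 1# ≤ g x) → ∀ xs → 1# ≤ ∏ g xs
    1≤∏ 1≤g []       = ≤-refl 1#
    1≤∏ 1≤g (x ∷ xs) = 1≤x*y (1≤g x) (1≤∏ 1≤g xs)

    0≤∏ : ∀ {g} → (∀ x → 0# ≤ g x) → ∀ xs → 0# ≤ ∏ g xs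
    0≤∏ 0≤g []       = 0≤1
    0≤∏ 0≤g (x ∷ xs) = *-nonneg (0≤g x) (0≤∏ 0≤g xs)

    ∑-filterᵇ : ∀ (p : X → Bool) g xs →
                ∑ g (filterᵇ p xs) ≡ ∑ (λ x → if p x then g x else 0#) xs
    ∑-filterᵇ p g []       = refl
    ∑-filterᵇ p g (x ∷ xs) with p x
    ... | true  = cong (g x +_) (∑-filterᵇ p g xs)
    ... | false = trans (∑-filterᵇ p g xs) (sym (+-identityˡ _))

    ∏-filterᵇ : ∀ (p : X → Bool) g xs →
                ∏ g (filterᵇ p xs) ≡ ∏ (λ x → if p x then g x else 1#) xs
    ∏-filterᵇ p g []       = refl
    ∏-filterᵇ p g (x ∷ xs) with p x
    ... | true  = cong (g x *_) (∏-filterᵇ p g xs)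
    ... | false = trans (∏-filterᵇ p g xs) (sym (*-identityˡ _))

    ∑-↭ : ∀ g {xs ys} → xs ↭ ys → ∑ g xs ≡ ∑ g ys
    ∑-↭ g xs↭ys = ↭ₛ.foldr-commMonoid +-isCommutativeMonoid (↭⇒↭ₛ (↭.map⁺ g xs↭ys))

    ∏-↭ : ∀ g {xs ys} → xs ↭ ys → ∏ g xs ≡ ∏ g ys
    ∏-↭ g xs↭ys = ↭ₛ.foldr-commMonoid *-isCommutativeMonoid (↭⇒↭ₛ (↭.map⁺ g xs↭ys))

  ∏-allFin-suc : ∀ {n} (g : Fin (suc n) → Carrier) →
                 ∏ g (allFin (suc n)) ≡ g fzero * ∏ (g ∘ fsuc) (allFin n)
  ∏-allFin-suc g = cong (prodL F) (map-allFin-suc g)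

  ∏-setTrue : ∀ {n} (X : Fin n → Bool) (h : Fin n → Carrier) s → X s ≡ false →
    ∏ (λ t → if setTrue X s t then h t else 1#) (allFin n)
      ≡ h s * ∏ (λ t → if X t then h t else 1#) (allFin n)
  ∏-setTrue {suc n} X h fzero Xs≡false
    rewrite ∏-allFin-suc (λ t → if setTrue X fzero t then h t else 1#)
          | ∏-allFin-suc (λ t → if X t then h t else 1#) | Xs≡false
    = cong (h fzero *_) (sym (*-identityˡ _))
  ∏-setTrue {suc n} X h (fsuc s) Xs≡false
    rewrite ∏-allFin-suc (λ t → if setTrue X (fsuc s) t then h t else 1#)
          | ∏-allFin-suc (λ t → if X t then h t else 1#)
    = trans (cong (_ *_) (∏-setTrue (X ∘ fsuc) (h ∘ fsuc) s Xs≡false))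
            (solve 3 (λ a b u → a :* (b :* u) := b :* (a :* u)) refl _ _ _)

module OCSExpectation {c ℓ} (F : OrderedField c ℓ) (f : ℕ → OrderedField.Carrier F)
                      (1≤f : ∀ l → OrderedField._≤_ F (OrderedField.1# F) (f l)) {nS : ℕ} where
  open OrderedField F
  open OrderedFieldProperties F
  open BigOperators F

  available : Request nS → Matched nS → Fin nS → Bool
  available q M s = q s ∧ not (M s)

  weight : List (Request nS) → Request nS → Matched nS → Fin nS → Carrier
  weight past q M s = if available q M s then f (nbrCount past s) else 0#

  totalWeight : List (Request nS) → Request nS → Matched nS → Carrier
  totalWeight past q M = ∑ (weight past q M) (allFin nS)

  𝔼₁ : (Matched nS → Carrier) → List (Request nS) → Request nS → Matched nS → Carrier
  𝔼₁ ψ past q M = if any (available q M) (allFin nS)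
    then ∑ (λ s → (weight past q M s * totalWeight past q M ⁻¹) * ψ (setTrue M s)) (allFin nS)
    else ψ M

  𝔼 : (Matched nS → Carrier) → List (Request nS) → List (Request nS) → Matched nS → Carrier
  𝔼 φ past []       M = φ M
  𝔼 φ past (q ∷ qs) M = 𝔼₁ (𝔼 φ (past ++ [ q ]) qs) past q M

  0≤weight : ∀ past q M s → 0# ≤ weight past q M s
  0≤weight past q M s with available q M s
  ... | true  = ≤-trans 0≤1 (1≤f _)
  ... | false = ≤-refl 0#

  1≤totalWeight : ∀ past q M → any (available q M) (allFin nS) ≡ true →
                  1# ≤ totalWeight past q M
  1≤totalWeight past q M = 1≤∑ (available q M) (0≤weight past q M) 1≤weight (allFin nS)
    where
    1≤weight : ∀ s → available q M s ≡ true → 1# ≤ weight past q M s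
    1≤weight s available≡true rewrite available≡true = 1≤f _

  𝔼₁-cong : ∀ ψ ψ′ → (∀ M → ψ M ≡ ψ′ M) → ∀ past q M → 𝔼₁ ψ past q M ≡ 𝔼₁ ψ′ past q M
  𝔼₁-cong ψ ψ′ ψ≗ψ′ past q M with any (available q M) (allFin nS)
  ... | true  = ∑-cong (λ s → cong (_ *_) (ψ≗ψ′ (setTrue M s))) (allFin nS)
  ... | false = ψ≗ψ′ M

  𝔼₁-mono-≤ : ∀ ψ ψ′ → (∀ M → ψ M ≤ ψ′ M) → ∀ past q M → 𝔼₁ ψ past q M ≤ 𝔼₁ ψ′ past q M
  𝔼₁-mono-≤ ψ ψ′ ψ≤ψ′ past q M with any (available q M) (allFin nS) in some-available
  ... | true  = ∑-mono-≤ (λ s → *-monoˡ-≤ _ (0≤probability s) (ψ≤ψ′ (setTrue M s))) (allFin nS)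
    where
    0≤probability : ∀ s → 0# ≤ weight past q M s * totalWeight past q M ⁻¹
    0≤probability s = *-nonneg (0≤weight past q M s)
                        (0≤x⁻¹ (1≤⇒positive (1≤totalWeight past q M some-available)))
  ... | false = ψ≤ψ′ M

  𝔼₁-+ : ∀ ψ ψ′ past q M → 𝔼₁ (λ M′ → ψ M′ + ψ′ M′) past q M ≡ 𝔼₁ ψ past q M + 𝔼₁ ψ′ past q M
  𝔼₁-+ ψ ψ′ past q M with any (available q M) (allFin nS)
  ... | true  = trans (∑-cong (λ s → distribˡ _ (ψ (setTrue M s)) (ψ′ (setTrue M s))) (allFin nS))
                      (∑-+ _ _ (allFin nS))
  ... | false = refl

  𝔼₁-*ˡ : ∀ a ψ past q M → 𝔼₁ (λ M′ → a * ψ M′) past q M ≡ a * 𝔼₁ ψ past q M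
  𝔼₁-*ˡ a ψ past q M with any (available q M) (allFin nS)
  ... | true  = trans (∑-cong (λ s → swap-scalars _ (ψ (setTrue M s))) (allFin nS)) (∑-*ˡ a _ (allFin nS))
    where
    swap-scalars : ∀ p x → p * (a * x) ≡ a * (p * x)
    swap-scalars p x = solve 3 (λ p a x → p :* (a :* x) := a :* (p :* x)) refl p a x
  ... | false = refl

  𝔼₁-zero : ∀ past q M → 𝔼₁ (λ _ → 0#) past q M ≡ 0#
  𝔼₁-zero past q M with any (available q M) (allFin nS)
  ... | true  = ∑-zero (λ s → zeroʳ _) (allFin nS)
  ... | false = refl

  𝔼-cong : ∀ {φ φ′} → (∀ M → φ M ≡ φ′ M) → ∀ past qs M → 𝔼 φ past qs M ≡ 𝔼 φ′ past qs M
  𝔼-cong φ≗φ′ past []       M = φ≗φ′ M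
  𝔼-cong {φ} {φ′} φ≗φ′ past (q ∷ qs) M =
    𝔼₁-cong (𝔼 φ next qs) (𝔼 φ′ next qs) (𝔼-cong φ≗φ′ next qs) past q M
    where next = past ++ [ q ]

  𝔼-mono-≤ : ∀ {φ φ′} → (∀ M → φ M ≤ φ′ M) → ∀ past qs M → 𝔼 φ past qs M ≤ 𝔼 φ′ past qs M
  𝔼-mono-≤ φ≤φ′ past []       M = φ≤φ′ M
  𝔼-mono-≤ {φ} {φ′} φ≤φ′ past (q ∷ qs) M =
    𝔼₁-mono-≤ (𝔼 φ next qs) (𝔼 φ′ next qs) (𝔼-mono-≤ φ≤φ′ next qs) past q M
    where next = past ++ [ q ]

  𝔼-+ : ∀ φ φ′ past qs M → 𝔼 (λ M′ → φ M′ + φ′ M′) past qs M ≡ 𝔼 φ past qs M + 𝔼 φ′ past qs M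
  𝔼-+ φ φ′ past []       M = refl
  𝔼-+ φ φ′ past (q ∷ qs) M = trans
    (𝔼₁-cong _ (λ M′ → 𝔼 φ next qs M′ + 𝔼 φ′ next qs M′) (𝔼-+ φ φ′ next qs) past q M)
    (𝔼₁-+ (𝔼 φ next qs) (𝔼 φ′ next qs) past q M)
    where next = past ++ [ q ]

  𝔼-*ˡ : ∀ a φ past qs M → 𝔼 (λ M′ → a * φ M′) past qs M ≡ a * 𝔼 φ past qs M
  𝔼-*ˡ a φ past []       M = refl
  𝔼-*ˡ a φ past (q ∷ qs) M = trans
    (𝔼₁-cong _ (λ M′ → a * 𝔼 φ next qs M′) (𝔼-*ˡ a φ next qs) past q M)
    (𝔼₁-*ˡ a (𝔼 φ next qs) past q M)
    where next = past ++ [ q ]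

  𝔼-zero : ∀ past qs M → 𝔼 (λ _ → 0#) past qs M ≡ 0#
  𝔼-zero past []       M = refl
  𝔼-zero past (q ∷ qs) M =
    trans (𝔼₁-cong _ (λ _ → 0#) (𝔼-zero (past ++ [ q ]) qs) past q M) (𝔼₁-zero past q M)

  𝔼-∑ : ∀ {X : Set} (a : X → Carrier) (φ : X → Matched nS → Carrier) xs past qs M →
        𝔼 (λ M′ → ∑ (λ x → a x * φ x M′) xs) past qs M ≡ ∑ (λ x → a x * 𝔼 (φ x) past qs M) xs
  𝔼-∑ a φ []       past qs M = 𝔼-zero past qs M
  𝔼-∑ a φ (x ∷ xs) past qs M =
    trans (𝔼-+ _ _ past qs M) (cong₂ _+_ (𝔼-*ˡ (a x) (φ x) past qs M) (𝔼-∑ a φ xs past qs M))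

  𝔼-∷ʳ : ∀ φ past qs q M → 𝔼 φ past (qs ++ [ q ]) M ≡ 𝔼 (𝔼₁ φ (past ++ qs) q) past qs M
  𝔼-∷ʳ φ past []        q M rewrite List.++-identityʳ past = refl
  𝔼-∷ʳ φ past (q′ ∷ qs) q M =
    𝔼₁-cong _ (𝔼 (𝔼₁ φ (past ++ q′ ∷ qs) q) next qs) (λ M′ → trans (𝔼-∷ʳ φ next qs q M′)
      (𝔼-cong (λ M″ → cong (λ p → 𝔼₁ φ p q M″) reassociate) next qs M′)) past q′ M
    where
    next = past ++ [ q′ ]
    reassociate : next ++ qs ≡ past ++ q′ ∷ qs
    reassociate = List.++-assoc past [ q′ ] qs

  go≡𝔼 : ∀ A past qs M → OCS.go F f A past qs M ≡ 𝔼 (OCS.allUnmatched F f A) past qs M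
  go≡𝔼 A past []       M = refl
  go≡𝔼 A past (q ∷ qs) M =
    𝔼₁-cong _ (𝔼 (OCS.allUnmatched F f A) next qs) (go≡𝔼 A next qs) past q M
    where next = past ++ [ q ]

module Analysis {c ℓ} (F : OrderedField c ℓ) (d : ℕ) (1≤d : 1 ℕ.≤ d)
                (f : ℕ → OrderedField.Carrier F) (candidate : Candidate F d f) (nS : ℕ) where
  open OrderedField F
  open OrderedFieldProperties F
  open BigOperators F

  f-mono : NonDecreasing F f
  f-mono = proj₁ candidate

  f0≡1 : f 0 ≡ 1#
  f0≡1 = proj₁ (proj₂ candidate)

  1≤f : ∀ l → 1# ≤ f l
  1≤f l = ≤-respˡ-≡ f0≡1 (f-mono 0 l ℕ.z≤n)

  0≤f : ∀ l → 0# ≤ f l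
  0≤f l = ≤-trans 0≤1 (1≤f l)

  candidateInequality : CandidateIneq F d f
  candidateInequality = proj₂ (proj₂ candidate)

  ratio : ℕ → Carrier
  ratio l = f (suc l) * f l ⁻¹

  0≤ratio : ∀ l → 0# ≤ ratio l
  0≤ratio l = *-nonneg (0≤f (suc l)) (0≤x⁻¹ (1≤⇒positive (1≤f l)))

  f*ratio≡f∘suc : ∀ l → f l * ratio l ≡ f (suc l)
  f*ratio≡f∘suc l = begin
    f l * (f (suc l) * f l ⁻¹)  ≡⟨ solve 3 (λ x y z → x :* (y :* z) := y :* (x :* z)) refl _ _ _ ⟩
    f (suc l) * (f l * f l ⁻¹)  ≡⟨ cong (f (suc l) *_) (x*x⁻¹≡1 (proj₂ (1≤⇒positive (1≤f l)))) ⟩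
    f (suc l) * 1#              ≡⟨ *-identityʳ _ ⟩
    f (suc l)                   ∎
    where open ≡-Reasoning

  open OCSExpectation F f 1≤f {nS} public

  meets : (Fin nS → Bool) → Matched nS → Bool
  meets A M = any (λ t → A t ∧ M t) (allFin nS)

  unmatched : (Fin nS → Bool) → Matched nS → Carrier
  unmatched = OCS.allUnmatched F f

  0≤unmatched : ∀ A M → 0# ≤ unmatched A M
  0≤unmatched A M with meets A M
  ... | true  = ≤-refl 0#
  ... | false = 0≤1

  unmatched-setTrueʳ : ∀ A M s →
                       unmatched A (setTrue M s) ≡ (if A s ∨ meets A M then 0# else 1#)
  unmatched-setTrueʳ A M s = cong (if_then 0# else 1#) (any-∧-setTrue A M s)

  unmatched-setTrueˡ : ∀ A M s →
                       unmatched (setTrue A s) M ≡ (if M s ∨ meets A M then 0# else 1#)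
  unmatched-setTrueˡ A M s = cong (if_then 0# else 1#) (any-setTrue-∧ A M s)

  Q : List (Request nS) → (Fin nS → Bool) → Carrier
  Q past A = ∏ (λ s → if A s then f (nbrCount past s) else 1#) (allFin nS)

  1≤Q : ∀ past A → 1# ≤ Q past A
  1≤Q past A = 1≤∏ 1≤factor (allFin nS)
    where
    1≤factor : ∀ s → 1# ≤ (if A s then f (nbrCount past s) else 1#)
    1≤factor s with A s
    ... | true  = 1≤f _
    ... | false = ≤-refl 1#

  nothingMatched : Matched nS
  nothingMatched _ = false

  Invariant : List (Request nS) → Set ℓ
  Invariant past = ∀ A → 𝔼 (unmatched A) [] past nothingMatched * Q past A ≤ 1#

  module Round (pre : List (Request nS)) (q : Request nS) (A : Fin nS → Bool) where

    l : Fin nS → ℕ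
    l s = nbrCount pre s

    shared fresh : Fin nS → Bool
    shared s = A s ∧ q s
    fresh  s = q s ∧ not (A s)

    sharedWeight : Carrier
    sharedWeight = ∑ (λ s → if shared s then f (l s) else 0#) (allFin nS)

    m : ℕ
    m = countB shared (allFin nS)

    k : Carrier
    k = fromℕ F (d ∸ m)

    D : Carrier
    D = ((k + sharedWeight) * (k + sharedWeight)) ⁻¹

    freshWeight : Fin nS → Carrier
    freshWeight s = if fresh s then f (l s) else 0#

    -- (k² + c·Y)/(k+c)² with Y = Σ_{s fresh} f(l s)·[A ∪ {s} unmatched], linear in the indicators.
    bound : Matched nS → Carrier
    bound M = (k * k * D) * unmatched A M
            + (sharedWeight * D) * ∑ (λ s → freshWeight s * unmatched (setTrue A s) M) (allFin nS)

    0≤sharedWeight : 0# ≤ sharedWeight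
    0≤sharedWeight = 0≤∑ 0≤term (allFin nS)
      where
      0≤term : ∀ s → 0# ≤ (if shared s then f (l s) else 0#)
      0≤term s with shared s
      ... | true  = 0≤f _
      ... | false = ≤-refl 0#

    m≤sharedWeight : fromℕ F m ≤ sharedWeight
    m≤sharedWeight =
      ≤-respˡ-≡ (∑-indicator shared (allFin nS)) (∑-mono-≤ indicator≤term (allFin nS))
      where
      indicator≤term : ∀ s → (if shared s then 1# else 0#) ≤ (if shared s then f (l s) else 0#)
      indicator≤term s with shared s
      ... | true  = 1≤f _
      ... | false = ≤-refl 0#

    k+sharedWeight>0 : Positive (k + sharedWeight)
    k+sharedWeight>0 with m ℕ.<? d
    ... | yes m<d = 1≤⇒positive (≤-trans (1≤fromℕ (ℕ.m<n⇒0<n∸m m<d))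
                      (≤-respˡ-≡ (+-identityʳ k) (+-monoʳ-≤ k 0≤sharedWeight)))
    ... | no  m≮d = 1≤⇒positive (≤-trans (1≤fromℕ (ℕ.≤-trans 1≤d (ℕ.≮⇒≥ m≮d)))
                      (≤-trans m≤sharedWeight
                        (≤-respˡ-≡ (+-identityˡ sharedWeight)
                          (+-monoˡ-≤ sharedWeight (0≤fromℕ (d ∸ m))))))

    [k+c]²≢0 : (k + sharedWeight) * (k + sharedWeight) ≢ 0#
    [k+c]²≢0 = proj₂ (positive-* k+sharedWeight>0 k+sharedWeight>0)

    0≤D : 0# ≤ D
    0≤D = 0≤x⁻¹ (positive-* k+sharedWeight>0 k+sharedWeight>0)

    k/[k+c] : Carrier
    k/[k+c] = k * (k + sharedWeight) * D

    0≤freshWeight : ∀ s → 0# ≤ freshWeight s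
    0≤freshWeight s with fresh s
    ... | true  = 0≤f _
    ... | false = ≤-refl 0#

    0≤bound : ∀ M → 0# ≤ bound M
    0≤bound M = ≤-respˡ-≡ (+-identityˡ 0#) (+-mono-≤
      (*-nonneg (*-nonneg (0≤x*x k) 0≤D) (0≤unmatched A M))
      (*-nonneg (*-nonneg 0≤sharedWeight 0≤D)
        (0≤∑ (λ s → *-nonneg (0≤freshWeight s) (0≤unmatched (setTrue A s) M)) (allFin nS))))

    𝔼₁-unmatched-meets : ∀ M → meets A M ≡ true → 𝔼₁ (unmatched A) pre q M ≡ 0#
    𝔼₁-unmatched-meets M meets≡true with any (available q M) (allFin nS)
    ... | true  = ∑-zero term≡0 (allFin nS)
      where
      term≡0 : ∀ s → (weight pre q M s * totalWeight pre q M ⁻¹) * unmatched A (setTrue M s) ≡ 0#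
      term≡0 s rewrite unmatched-setTrueʳ A M s | meets≡true | Bool.∨-zeroʳ (A s) = zeroʳ _
    ... | false rewrite meets≡true = refl

    module Disjoint (M : Matched nS) (disjoint : meets A M ≡ false) where

      A∧M≡false : ∀ s → A s ∧ M s ≡ false
      A∧M≡false = any-allFin≡false (λ t → A t ∧ M t) disjoint

      freeWeight : Carrier
      freeWeight = ∑ (λ s → if A s then 0# else weight pre q M s) (allFin nS)

      totalWeight≡ : totalWeight pre q M ≡ sharedWeight + freeWeight
      totalWeight≡ = trans (∑-cong split (allFin nS))
        (trans (∑-+ _ _ (allFin nS)) (cong (_+ freeWeight) (∑-cong onA (allFin nS))))
        where
        split : ∀ s → weight pre q M s
                    ≡ (if A s then weight pre q M s else 0#) + (if A s then 0# else weight pre q M s)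
        split s with A s
        ... | true  = sym (+-identityʳ _)
        ... | false = sym (+-identityˡ _)
        onA : ∀ s → (if A s then weight pre q M s else 0#) ≡ (if shared s then f (l s) else 0#)
        onA s with A s | M s | q s | A∧M≡false s
        ... | false | _     | _     | _ = refl
        ... | true  | false | true  | _ = refl
        ... | true  | false | false | _ = refl

      ∑freshWeight≡freeWeight :
        ∑ (λ s → freshWeight s * unmatched (setTrue A s) M) (allFin nS) ≡ freeWeight
      ∑freshWeight≡freeWeight = ∑-cong term (allFin nS)
        where
        term : ∀ s → freshWeight s * unmatched (setTrue A s) M ≡ (if A s then 0# else weight pre q M s)
        term s rewrite unmatched-setTrueˡ A M s | disjoint with A s | q s | M s
        ... | true  | true  | _     = zeroˡ _
        ... | true  | false | _     = zeroˡ _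
        ... | false | false | _     = zeroˡ _
        ... | false | true  | true  = zeroʳ _
        ... | false | true  | false = *-identityʳ _

      bound≡ : bound M ≡ (k * k + sharedWeight * freeWeight) * D
      bound≡ rewrite disjoint | ∑freshWeight≡freeWeight =
        solve 4 (λ k c y D → (k :* k :* D) :* con 1 :+ (c :* D) :* y := (k :* k :+ c :* y) :* D)
          refl k sharedWeight freeWeight D

      𝔼₁-unmatched-available : any (available q M) (allFin nS) ≡ true →
                               𝔼₁ (unmatched A) pre q M ≡ freeWeight * totalWeight pre q M ⁻¹
      𝔼₁-unmatched-available some-available rewrite some-available =
        trans (∑-cong term (allFin nS)) (∑-*ʳ _ _ (allFin nS))
        where
        term : ∀ s → (weight pre q M s * totalWeight pre q M ⁻¹) * unmatched A (setTrue M s)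
                   ≡ (if A s then 0# else weight pre q M s) * totalWeight pre q M ⁻¹
        term s rewrite unmatched-setTrueʳ A M s | disjoint with A s
        ... | true  = trans (zeroʳ _) (sym (zeroˡ _))
        ... | false = *-identityʳ _

      sharedWeight≡0 : any (available q M) (allFin nS) ≡ false → sharedWeight ≡ 0#
      sharedWeight≡0 none-available = ∑-zero term (allFin nS)
        where
        term : ∀ s → (if shared s then f (l s) else 0#) ≡ 0#
        term s with A s | q s | M s | A∧M≡false s | any-allFin≡false (available q M) none-available s
        ... | false | _     | _     | _  | _  = refl
        ... | true  | false | _     | _  | _  = refl
        ... | true  | true  | true  | () | _
        ... | true  | true  | false | _  | ()

      𝔼₁-unmatched≤bound : ∀ b → any (available q M) (allFin nS) ≡ b →
                           𝔼₁ (unmatched A) pre q M ≤ bound M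
      𝔼₁-unmatched≤bound true some-available =
        ≤-respˡ-≡ (sym (trans (𝔼₁-unmatched-available some-available)
                              (cong (λ W → freeWeight * W ⁻¹) totalWeight≡)))
          (≤-respʳ-≡ (sym bound≡)
            (y/[c+y]≤tangent k sharedWeight freeWeight 0≤sharedWeight
              (subst Positive totalWeight≡ (1≤⇒positive (1≤totalWeight pre q M some-available)))
              k+sharedWeight>0))
      𝔼₁-unmatched≤bound false none-available = ≤-reflexive (begin
        𝔼₁ (unmatched A) pre q M                             ≡⟨ 𝔼₁-none ⟩
        unmatched A M                                        ≡⟨ cong (if_then 0# else 1#) disjoint ⟩
        1#                                                   ≡⟨ sym (x*x⁻¹≡1 [k+c]²≢0) ⟩
        (k + sharedWeight) * (k + sharedWeight) * D          ≡⟨ cong (_* D) k²+cy≡[k+c]² ⟨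
        (k * k + sharedWeight * freeWeight) * D              ≡⟨ bound≡ ⟨
        bound M                                              ∎)
        where
        open ≡-Reasoning
        𝔼₁-none : 𝔼₁ (unmatched A) pre q M ≡ unmatched A M
        𝔼₁-none rewrite none-available = refl
        k²+cy≡[k+c]² : k * k + sharedWeight * freeWeight ≡ (k + sharedWeight) * (k + sharedWeight)
        k²+cy≡[k+c]² rewrite sharedWeight≡0 none-available =
          solve 2 (λ k y → k :* k :+ con 0 :* y := (k :+ con 0) :* (k :+ con 0)) refl k freeWeight

    𝔼₁-unmatched≤bound : ∀ M → 𝔼₁ (unmatched A) pre q M ≤ bound M
    𝔼₁-unmatched≤bound M = by-cases (meets A M) refl
      where
      by-cases : ∀ b → meets A M ≡ b → 𝔼₁ (unmatched A) pre q M ≤ bound M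
      by-cases true  meets≡true  = ≤-respˡ-≡ (sym (𝔼₁-unmatched-meets M meets≡true)) (0≤bound M)
      by-cases false meets≡false = Disjoint.𝔼₁-unmatched≤bound M meets≡false _ refl

    private
      𝔼ₚ : (Matched nS → Carrier) → Carrier
      𝔼ₚ φ = 𝔼 φ [] pre nothingMatched

    𝔼-bound≡ : 𝔼ₚ bound
             ≡ (k * k * D) * 𝔼ₚ (unmatched A)
               + (sharedWeight * D) * ∑ (λ s → freshWeight s * 𝔼ₚ (unmatched (setTrue A s))) (allFin nS)
    𝔼-bound≡ = trans (𝔼-+ _ _ [] pre nothingMatched) (cong₂ _+_
      (𝔼-*ˡ (k * k * D) (unmatched A) [] pre nothingMatched)
      (trans (𝔼-*ˡ (sharedWeight * D) _ [] pre nothingMatched)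
        (cong ((sharedWeight * D) *_)
          (𝔼-∑ freshWeight (unmatched ∘ setTrue A) (allFin nS) [] pre nothingMatched))))

    freshTerm≤indicator : Invariant pre → ∀ s →
      (freshWeight s * 𝔼ₚ (unmatched (setTrue A s))) * Q pre A ≤ (if fresh s then 1# else 0#)
    freshTerm≤indicator invariant s with A s in As≡ | q s
    ... | true  | true  = ≤-reflexive (trans (cong (_* Q pre A) (zeroˡ _)) (zeroˡ _))
    ... | true  | false = ≤-reflexive (trans (cong (_* Q pre A) (zeroˡ _)) (zeroˡ _))
    ... | false | false = ≤-reflexive (trans (cong (_* Q pre A) (zeroˡ _)) (zeroˡ _))
    ... | false | true  = ≤-respˡ-≡ (sym regroup) (invariant (setTrue A s))
      where
      e = 𝔼ₚ (unmatched (setTrue A s))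
      regroup : (f (l s) * e) * Q pre A ≡ e * Q pre (setTrue A s)
      regroup = trans (solve 3 (λ x y z → (x :* y) :* z := y :* (x :* z)) refl (f (l s)) e (Q pre A))
                      (cong (e *_) (sym (∏-setTrue A (λ t → f (nbrCount pre t)) s As≡)))

    𝔼-𝔼₁-unmatched*Q≤k/[k+c] : Invariant pre → countB fresh (allFin nS) ℕ.≤ d ∸ m →
                         𝔼ₚ (𝔼₁ (unmatched A) pre q) * Q pre A ≤ k/[k+c]
    𝔼-𝔼₁-unmatched*Q≤k/[k+c] invariant #fresh≤d-m = begin
      𝔼ₚ (𝔼₁ (unmatched A) pre q) * QA
        ≲⟨ *-monoʳ-≤ QA 0≤QA (𝔼-mono-≤ 𝔼₁-unmatched≤bound [] pre nothingMatched) ⟩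
      𝔼ₚ bound * QA
        ≡⟨ cong (_* QA) 𝔼-bound≡ ⟩
      (a * 𝔼ₚ (unmatched A) + b * ∑ freshTerm (allFin nS)) * QA
        ≡⟨ solve 5 (λ a b e t Q → (a :* e :+ b :* t) :* Q := a :* (e :* Q) :+ b :* (t :* Q))
                   refl a b (𝔼ₚ (unmatched A)) (∑ freshTerm (allFin nS)) QA ⟩
      a * (𝔼ₚ (unmatched A) * QA) + b * (∑ freshTerm (allFin nS) * QA)
        ≡⟨ cong (λ x → a * (𝔼ₚ (unmatched A) * QA) + b * x) (sym (∑-*ʳ QA freshTerm (allFin nS))) ⟩
      a * (𝔼ₚ (unmatched A) * QA) + b * ∑ (λ s → freshTerm s * QA) (allFin nS)
        ≲⟨ +-mono-≤ (*-monoˡ-≤ a 0≤a (invariant A))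
                    (*-monoˡ-≤ b 0≤b (∑-mono-≤ (freshTerm≤indicator invariant) (allFin nS))) ⟩
      a * 1# + b * ∑ (λ s → if fresh s then 1# else 0#) (allFin nS)
        ≡⟨ cong (λ x → a * 1# + b * x) (∑-indicator fresh (allFin nS)) ⟩
      a * 1# + b * fromℕ F (countB fresh (allFin nS))
        ≲⟨ +-monoʳ-≤ (a * 1#) (*-monoˡ-≤ b 0≤b (fromℕ-mono-≤ #fresh≤d-m)) ⟩
      a * 1# + b * k
        ≡⟨ solve 3 (λ k c D → (k :* k :* D) :* con 1 :+ (c :* D) :* k := k :* (k :+ c) :* D)
                   refl k sharedWeight D ⟩
      k/[k+c] ∎
      where
      open ≤-Reasoning
      QA = Q pre A
      a = k * k * D
      b = sharedWeight * D
      freshTerm : Fin nS → Carrier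
      freshTerm s = freshWeight s * 𝔼ₚ (unmatched (setTrue A s))
      0≤QA : 0# ≤ QA
      0≤QA = ≤-trans 0≤1 (1≤Q pre A)
      0≤a : 0# ≤ a
      0≤a = *-nonneg (0≤x*x k) 0≤D
      0≤b : 0# ≤ b
      0≤b = *-nonneg 0≤sharedWeight 0≤D

    growth : Carrier
    growth = ∏ (λ s → if shared s then ratio (l s) else 1#) (allFin nS)

    0≤growth : 0# ≤ growth
    0≤growth = 0≤∏ 0≤factor (allFin nS)
      where
      0≤factor : ∀ s → 0# ≤ (if shared s then ratio (l s) else 1#)
      0≤factor s with shared s
      ... | true  = 0≤ratio (l s)
      ... | false = 0≤1

    Q-∷ʳ : Q (pre ++ [ q ]) A ≡ Q pre A * growth
    Q-∷ʳ = trans (∏-cong factor (allFin nS)) (∏-* _ _ (allFin nS))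
      where
      factor : ∀ s → (if A s then f (nbrCount (pre ++ [ q ]) s) else 1#)
                   ≡ (if A s then f (l s) else 1#) * (if shared s then ratio (l s) else 1#)
      factor s rewrite countB-∷ʳ (λ r → r s) pre q with A s | q s
      ... | true  | true  = sym (f*ratio≡f∘suc (l s))
      ... | true  | false = sym (*-identityʳ _)
      ... | false | _     = sym (*-identityˡ 1#)

    growth≤ : m ℕ.< d → growth ≤ 1# + sharedWeight * k ⁻¹
    growth≤ m<d = ≤-respˡ-≡ ∏ratio≡growth
      (≤-respʳ-≡ (cong₂ (λ a n → 1# + a * fromℕ F (d ∸ n) ⁻¹) ∑f≡sharedWeight length≡m)
        (candidateInequality ls (subst (ℕ._< d) (sym length≡m) m<d) (sort-↗ sharedLevels)))
      where
      sharedServers = filterᵇ shared (allFin nS)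
      sharedLevels = map l sharedServers
      ls = sort sharedLevels
      length≡m : length ls ≡ m
      length≡m = trans (↭.↭-length (sort-↭ sharedLevels))
                   (trans (List.length-map l sharedServers) (length-filterᵇ shared (allFin nS)))
      ∏ratio≡growth : ∏ ratio ls ≡ growth
      ∏ratio≡growth = trans (∏-↭ ratio (sort-↭ sharedLevels))
        (trans (cong (prodL F) (sym (List.map-∘ {g = ratio} {f = l} sharedServers)))
               (∏-filterᵇ shared (ratio ∘ l) (allFin nS)))
      ∑f≡sharedWeight : ∑ f ls ≡ sharedWeight
      ∑f≡sharedWeight = trans (∑-↭ f (sort-↭ sharedLevels))
        (trans (cong (sumL F) (sym (List.map-∘ {g = f} {f = l} sharedServers)))
               (∑-filterᵇ shared (f ∘ l) (allFin nS)))

    k/[k+c]*growth≤1 : k/[k+c] * growth ≤ 1#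
    k/[k+c]*growth≤1 with m ℕ.<? d
    ... | yes m<d = ≤-trans (*-monoˡ-≤ k/[k+c] 0≤k/[k+c] (growth≤ m<d)) (≤-reflexive k/[k+c]*[1+c/k]≡1)
      where
      k≢0 : k ≢ 0#
      k≢0 = proj₂ (1≤⇒positive (1≤fromℕ (ℕ.m<n⇒0<n∸m m<d)))
      0≤k/[k+c] : 0# ≤ k/[k+c]
      0≤k/[k+c] = *-nonneg (*-nonneg (0≤fromℕ (d ∸ m)) (proj₁ k+sharedWeight>0)) 0≤D
      k/[k+c]*[1+c/k]≡1 : k/[k+c] * (1# + sharedWeight * k ⁻¹) ≡ 1#
      k/[k+c]*[1+c/k]≡1 = begin
        k * (k + sharedWeight) * D * (1# + sharedWeight * k ⁻¹)
          ≡⟨ solve 4 (λ k c D k′ → k :* (k :+ c) :* D :* (con 1 :+ c :* k′)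
                                := (k :+ c) :* D :* (k :+ c :* (k :* k′))) refl k sharedWeight D (k ⁻¹) ⟩
        (k + sharedWeight) * D * (k + sharedWeight * (k * k ⁻¹))
          ≡⟨ cong (λ x → (k + sharedWeight) * D * (k + sharedWeight * x)) (x*x⁻¹≡1 k≢0) ⟩
        (k + sharedWeight) * D * (k + sharedWeight * 1#)
          ≡⟨ solve 3 (λ k c D → (k :+ c) :* D :* (k :+ c :* con 1) := (k :+ c) :* (k :+ c) :* D)
                     refl k sharedWeight D ⟩
        (k + sharedWeight) * (k + sharedWeight) * D
          ≡⟨ x*x⁻¹≡1 [k+c]²≢0 ⟩
        1# ∎
        where open ≡-Reasoning
    ... | no m≮d = ≤-respˡ-≡ (sym k/[k+c]*growth≡0) 0≤1
      where
      k≡0 : k ≡ 0#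
      k≡0 = cong (fromℕ F) (ℕ.m≤n⇒m∸n≡0 (ℕ.≮⇒≥ m≮d))
      k/[k+c]*growth≡0 : k/[k+c] * growth ≡ 0#
      k/[k+c]*growth≡0 = begin
        k * (k + sharedWeight) * D * growth   ≡⟨ cong (λ x → x * (k + sharedWeight) * D * growth) k≡0 ⟩
        0# * (k + sharedWeight) * D * growth  ≡⟨ cong (λ x → x * D * growth) (zeroˡ _) ⟩
        0# * D * growth                       ≡⟨ cong (_* growth) (zeroˡ D) ⟩
        0# * growth                           ≡⟨ zeroˡ growth ⟩
        0#                                    ∎
        where open ≡-Reasoning

    invariant-∷ʳ : Invariant pre → reqDeg q ℕ.≤ d →
                   𝔼 (unmatched A) [] (pre ++ [ q ]) nothingMatched * Q (pre ++ [ q ]) A ≤ 1#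
    invariant-∷ʳ invariant deg≤d = begin
      𝔼 (unmatched A) [] (pre ++ [ q ]) nothingMatched * Q (pre ++ [ q ]) A
        ≡⟨ cong₂ _*_ (𝔼-∷ʳ (unmatched A) [] pre q nothingMatched) Q-∷ʳ ⟩
      𝔼ₚ (𝔼₁ (unmatched A) pre q) * (Q pre A * growth)
        ≡⟨ sym (*-assoc _ (Q pre A) growth) ⟩
      𝔼ₚ (𝔼₁ (unmatched A) pre q) * Q pre A * growth
        ≲⟨ *-monoʳ-≤ growth 0≤growth (𝔼-𝔼₁-unmatched*Q≤k/[k+c] invariant #fresh≤d∸m) ⟩
      k/[k+c] * growth
        ≲⟨ k/[k+c]*growth≤1 ⟩
      1# ∎
      where
      open ≤-Reasoning
      #fresh≤d∸m : countB fresh (allFin nS) ℕ.≤ d ∸ m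
      #fresh≤d∸m = ℕ.m+n≤o⇒m≤o∸n _ (subst (ℕ._≤ d) (countB-partition q A (allFin nS)) deg≤d)

  invariant-[] : Invariant []
  invariant-[] A = ≤-reflexive (trans (cong₂ _*_ nothing-unmatched Q[]≡1) (*-identityˡ 1#))
    where
    nothing-unmatched : unmatched A nothingMatched ≡ 1#
    nothing-unmatched =
      cong (if_then 0# else 1#) (∀false⇒any≡false (λ t → Bool.∧-zeroʳ (A t)) (allFin nS))
    Q[]≡1 : Q [] A ≡ 1#
    Q[]≡1 = trans (∏-cong factor≡1 (allFin nS)) (∏-one (allFin nS))
      where
      factor≡1 : ∀ s → (if A s then f 0 else 1#) ≡ 1#
      factor≡1 s with A s
      ... | true  = f0≡1
      ... | false = refl

  invariant : ∀ {past} → Reverse past → All (λ q → reqDeg q ℕ.≤ d) past → Invariant past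
  invariant []                 _    = invariant-[]
  invariant (pre ∶ view ∶ʳ q) degs A =
    Round.invariant-∷ʳ pre q A (invariant view (proj₁ (All.∷ʳ⁻ degs))) (proj₂ (All.∷ʳ⁻ degs))

lemma4p2 : ∀ {c ℓ} (F : OrderedField c ℓ) (d : ℕ) → 2 ℕ.≤ d →
    (f : ℕ → OrderedField.Carrier F) → Candidate F d f →
    (nS : ℕ) (rs : List (Request nS)) → Bounded d d rs →
    (A : Fin nS → Bool) (r : ℕ) → r ℕ.≤ length rs →
    OrderedField._≤_ F (OCS.ProbAllUnmatched F f rs r A)
      (OrderedField._⁻¹ F (OCS.prodF F f rs r A))
lemma4p2 F d 2≤d f candidate nS rs (_ , degrees≤d) A r _ =
  x*y≤1⇒x≤y⁻¹ (1≤⇒positive (1≤Q past A))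
    (≤-respˡ-≡ (cong (_* Q past A) (sym (go≡𝔼 A [] past nothingMatched)))
      (invariant (reverseView past) (All.take⁺ r degrees≤d) A))
  where
  open OrderedField F using (_*_)
  open OrderedFieldProperties F
  open Analysis F d (ℕ.≤-trans (ℕ.s≤s ℕ.z≤n) 2≤d) f candidate nS
  past = take r rs
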